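{- Let $I_{MR}$ be an instance of MIN-REP with inputs $G=(X,Y,E)$, $\mathcal{P}_X$, $\mathcal{P}_Y$, and let $I_D$ be the instance of the 1-DR-2 problem whose input graph is the graph $G'$ constructed from it as described in the context. If $I_{MR}$ has a (feasible) solution of size $s$, then $I_D$ has a (feasible) solution of size $s+4$.
   Context: MIN-REP problem: input a bipartite graph $G=(X,Y,E)$, a partition $\mathcal{P}_X=\{X_1,\dots,X_{k_X}\}$ of $X$ into sets of size $|X|/k_X$, and a partition $\mathcal{P}_Y=\{Y_1,\dots,Y_{k_Y}\}$ of $Y$ into sets of size $|Y|/k_Y$. $X_i$ and $Y_j$ form a super edge if some vertex of $X_i$ is adjacent in $G$ to some vertex of $Y_j$. A feasible solution is a set $S\subseteq X\cup Y$ such that for every super edge $(X_i,Y_j)$ there are $x\in S\cap X_i$ and $y\in S\cap Y_j$ with $(x,y)\in E$; the goal is to minimize $|S|$. Construction of $G'$: start with $G$. For each $X_i$ add two vertices $px^1_i,px^2_i$ and edges $(x,px^1_i),(x,px^2_i)$ for every $x\in X_i$; for each $Y_j$ add two vertices $py^1_j,py^2_j$ and edges $(y,py^1_j),(y,py^2_j)$ for every $y\in Y_j$. For each super edge $(X_i,Y_j)$ add two vertices (relays) $r^1_{i,j},r^2_{i,j}$ and edges $(px^1_i,r^1_{i,j}),(r^1_{i,j},py^1_j),(px^2_i,r^2_{i,j}),(r^2_{i,j},py^2_j)$. Let $PX$ be the set of all $px^I_i$, $PY$ the set of all $py^I_j$, $R$ the set of relays. Add four hubs $h_{X,R},h_{Y,R},h_{PX},h_{PY}$: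 $h_{X,R}$ is adjacent to every vertex of $X\cup R$, $h_{Y,R}$ to every vertex of $Y\cup R$, $h_{PX}$ to every vertex of $PX$, $h_{PY}$ to every vertex of $PY$, and the hubs form the 4-cycle $(h_{PX},h_{Y,R},h_{PY},h_{X,R},h_{PX})$. Finally, for each hub $h$ add two new vertices (dummy nodes) $d_1,d_2$ and edges $(h,d_1),(h,d_2)$. 1-DR-2 problem: for vertices $u,v$ of a graph $G'$, $m_{G'}(u,v)$ is the number of internal vertices on a shortest $u$–$v$ path ($\infty$ if none); for $D\subseteq V(G')$, $m^D(u,v)=m_{G'[D\cup\{u,v\}]}(u,v)$. Vertices $u,v$ form a target couple if $m_{G'}(u,v)=1$; $D$ covers it if $m^D(u,v)\le 2$. A feasible solution is a dominating set $D$ of $G'$ covering all target couples; the goal is to minimize $|D|$. -}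

module Defs where

open import Data.Nat using (ℕ; zero; suc; _∸_; _≤_)
open import Data.Fin using (Fin)
open import Data.Bool using (Bool; true; false; T; _∨_)
open import Data.Product using (Σ; ∃; ∃-syntax; _×_; _,_)
open import Data.Sum using (_⊎_; inj₁; inj₂)
open import Data.Unit using (⊤)
open import Data.List using (List; length)
open import Data.List.Membership.Propositional using (_∈_)
open import Data.List.Relation.Unary.Unique.Propositional using (Unique)
open import Relation.Nullary using (¬_)
open import Relation.Binary.PropositionalEquality using (_≡_)

data Walk {V : Set} (Adj : V → V → Set) (P : V → Set) : V → V → ℕ → Set where
  []  : ∀ {u} → P u → Walk Adj P u u 0
  _∷_ : ∀ {u w v n} → (P u × Adj u w) → Walk Adj P w v n → Walk Adj P u v (suc n)

-- m_H(u,v) ≤ k, where H is the subgraph induced by the vertices satisfying P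
-- (and containing u, v): some u–v walk in H has at most k internal vertices
-- (a walk with n edges has n ∸ 1 internal vertices; a shortest path is such
-- a walk, and any walk contains a path with no more internal vertices).
-- If no u–v path exists, m = ∞ and this is never satisfied.
m≤ : {V : Set} → (V → V → Set) → (V → Set) → V → V → ℕ → Set
m≤ Adj P u v k = ∃[ n ] (n ∸ 1 ≤ k × Walk Adj P u v n)

everything : {V : Set} → V → Set
everything _ = ⊤

TargetCouple : {V : Set} → (V → V → Set) → V → V → Set
TargetCouple Adj u v = m≤ Adj everything u v 1 × ¬ m≤ Adj everything u v 0

-- m^D(u,v) = m_{G'[D ∪ {u,v}]}(u,v)
InDuv : {V : Set} → List V → V → V → V → Set
InDuv D u v w = w ∈ D ⊎ (w ≡ u ⊎ w ≡ v)

Covers : {V : Set} → (V → V → Set) → List V → V → V → Set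
Covers Adj D u v = m≤ Adj (InDuv D u v) u v 2

Dominating : {V : Set} → (V → V → Set) → List V → Set
Dominating Adj D = ∀ v → v ∈ D ⊎ ∃[ w ] (w ∈ D × Adj v w)

DR2Feasible : {V : Set} → (V → V → Set) → List V → Set
DR2Feasible Adj D = Dominating Adj D × (∀ u v → TargetCouple Adj u v → Covers Adj D u v)

-- MIN-REP instances
-- X = Fin kX × Fin sX, where X_i = { (i , t) | t : Fin sX } (parts of equal
-- size sX = |X|/kX); similarly Y = Fin kY × Fin sY.  Edges given by a
-- Boolean adjacency E.

anyFin : (n : ℕ) → (Fin n → Bool) → Bool
anyFin zero    f = false
anyFin (suc n) f = f Fin.zero ∨ anyFin n (λ i → f (Fin.suc i))

record MinRep : Set where
  field
    kX sX kY sY : ℕ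
    E : Fin kX × Fin sX → Fin kY × Fin sY → Bool

  X : Set
  X = Fin kX × Fin sX

  Y : Set
  Y = Fin kY × Fin sY

  Edge : X → Y → Set
  Edge x y = T (E x y)

  superEdge? : Fin kX → Fin kY → Bool
  superEdge? i j = anyFin sX (λ t → anyFin sY (λ t' → E (i , t) (j , t')))

  SuperEdge : Fin kX → Fin kY → Set
  SuperEdge i j = T (superEdge? i j)

  -- feasible solution S ⊆ X ∪ Y (as a list; duplicate-freeness is required
  -- separately when measuring size)
  Feasible : List (X ⊎ Y) → Set
  Feasible S = ∀ i j → SuperEdge i j →
    ∃[ t ] ∃[ t' ] (inj₁ (i , t) ∈ S × inj₂ (j , t') ∈ S × Edge (i , t) (j , t'))

  HasSolutionOfSize : ℕ → Set
  HasSolutionOfSize s = ∃[ S ] (Feasible S × Unique S × length S ≡ s)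

data Hub : Set where
  hXR hYR hPX hPY : Hub

module _ (I : MinRep) where
  open MinRep I

  data V' : Set where
    xv    : X → V'
    yv    : Y → V'
    px    : Fin 2 → Fin kX → V'
    py    : Fin 2 → Fin kY → V'
    relay : Fin 2 → (i : Fin kX) (j : Fin kY) → SuperEdge i j → V'
    hub   : Hub → V'
    dummy : Hub → Fin 2 → V'

  -- (undirected) edges of G', listed once each
  data E' : V' → V' → Set where
    eG    : ∀ {x y} → Edge x y → E' (xv x) (yv y)
    eXP   : ∀ {i t} (c : Fin 2) → E' (xv (i , t)) (px c i)
    eYP   : ∀ {j t} (c : Fin 2) → E' (yv (j , t)) (py c j)
    ePXR  : ∀ {i j} (c : Fin 2) (p : SuperEdge i j) → E' (px c i) (relay c i j p)
    eRPY  : ∀ {i j} (c : Fin 2) (p : SuperEdge i j) → E' (relay c i j p) (py c j)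
    eHXRx : ∀ {x} → E' (hub hXR) (xv x)
    eHXRr : ∀ {c i j p} → E' (hub hXR) (relay c i j p)
    eHYRy : ∀ {y} → E' (hub hYR) (yv y)
    eHYRr : ∀ {c i j p} → E' (hub hYR) (relay c i j p)
    eHPX  : ∀ {c i} → E' (hub hPX) (px c i)
    eHPY  : ∀ {c j} → E' (hub hPY) (py c j)
    eC1   : E' (hub hPX) (hub hYR)
    eC2   : E' (hub hYR) (hub hPY)
    eC3   : E' (hub hPY) (hub hXR)
    eC4   : E' (hub hXR) (hub hPX)
    eDum  : ∀ {h} (d : Fin 2) → E' (hub h) (dummy h d)

  Adj' : V' → V' → Set
  Adj' u v = E' u v ⊎ E' v u

  DR2HasSolutionOfSize : ℕ → Set
  DR2HasSolutionOfSize s = ∃[ D ] (DR2Feasible Adj' D × Unique D × length D ≡ s)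

module Submission where

-- Proof idea.  Given a MIN-REP solution S, take D = the four hubs followed by
-- the vertices of S; it has size |S| + 4.
--
-- Every vertex of G' is "anchored" to some hub (equal or adjacent to it), so
-- D dominates.  For coverage, a target couple u, v is either joined by a
-- single hop or has a common neighbour w.  Call two hubs "near" if they are
-- equal or adjacent on the hub 4-cycle; if u is anchored to a and v to b with
-- a, b near, then u – a – b – v is a walk whose internal vertices are hubs,
-- hence in D.  When w is a hub this applies directly; when w is an X, Y, PX,
-- PY or dummy vertex, all neighbours of w are anchored to one of two near hubs
-- (w is a "star").  The only remaining case is a relay r^c_{i,j} between
-- px^c_i and py^c_j: there the super edge (X_i, Y_j) gives x ∈ S ∩ X_i and
-- y ∈ S ∩ Y_j adjacent in G, and px^c_i – x – y – py^c_j is the covering walk.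

open import Defs
open import Data.Nat using (ℕ; _+_; _≤_; suc; z≤n; s≤s)
open import Data.Nat.Properties using (+-comm; m≤n⇒m≤1+n; ∸-monoˡ-≤; ≤-trans)
open import Data.Fin using (Fin)
open import Data.Product using (∃-syntax; _×_; _,_)
open import Data.Sum using (_⊎_; inj₁; inj₂; swap)
import Data.Sum as Sum
open import Data.List using (List; _∷_; map; length)
open import Data.List.Properties using (length-map)
open import Data.List.Membership.Propositional using (_∈_)
open import Data.List.Membership.Propositional.Properties using (∈-map⁺)
open import Data.List.Relation.Unary.Any using (here; there)
open import Data.List.Relation.Unary.All using (All; _∷_; universal)
import Data.List.Relation.Unary.All.Properties as All
open import Data.List.Relation.Unary.AllPairs using (_∷_)
open import Data.List.Relation.Unary.Unique.Propositional using (Unique)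
import Data.List.Relation.Unary.Unique.Propositional.Properties as Unique
open import Relation.Binary.PropositionalEquality using (_≡_; _≢_; refl; sym; cong; trans)

Hop : {V : Set} → (V → V → Set) → V → V → Set
Hop Adj u v = u ≡ v ⊎ Adj u v

hop-sym : {V : Set} {Adj : V → V → Set} → (∀ {a b} → Adj a b → Adj b a) →
          ∀ {u v} → Hop Adj u v → Hop Adj v u
hop-sym adj-sym = Sum.map sym adj-sym

module Walks {V : Set} (Adj : V → V → Set) (P : V → Set) where

  ShortWalk : V → V → ℕ → Set
  ShortWalk u v n = ∃[ m ] (m ≤ n × Walk Adj P u v m)

  stay : ∀ {v} → P v → ShortWalk v v 0
  stay pv = 0 , z≤n , [] pv

  hop-prepend : ∀ {u a v n} → P u → Hop Adj u a → ShortWalk a v n → ShortWalk u v (suc n)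
  hop-prepend pu (inj₁ refl) (m , m≤n , w) = m , m≤n⇒m≤1+n m≤n , w
  hop-prepend pu (inj₂ e)    (m , m≤n , w) = suc m , s≤s m≤n , (pu , e) ∷ w

  weaken : ∀ {u v n n'} → n ≤ n' → ShortWalk u v n → ShortWalk u v n'
  weaken n≤n' (m , m≤n , w) = m , ≤-trans m≤n n≤n' , w

  shortWalk⇒m≤ : ∀ {u v k} → ShortWalk u v (suc k) → m≤ Adj P u v k
  shortWalk⇒m≤ (m , m≤1+k , w) = m , ∸-monoˡ-≤ 1 m≤1+k , w

m≤1⇒hop⊎common : {V : Set} {Adj : V → V → Set} {u v : V} →
                 m≤ Adj everything u v 1 →
                 Hop Adj u v ⊎ ∃[ w ] (Adj u w × Adj w v)
m≤1⇒hop⊎common (0 , _ , [] _)                         = inj₁ (inj₁ refl)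
m≤1⇒hop⊎common (1 , _ , (_ , a) ∷ [] _)               = inj₁ (inj₂ a)
m≤1⇒hop⊎common (2 , _ , (_ , a) ∷ (_ , b) ∷ [] _)     = inj₂ (_ , a , b)
m≤1⇒hop⊎common (suc (suc (suc _)) , s≤s () , _)

module Hubs (I : MinRep) where
  open MinRep I

  adj-sym : ∀ {u v} → Adj' I u v → Adj' I v u
  adj-sym = swap

  hop-sym' : ∀ {u v} → Hop (Adj' I) u v → Hop (Adj' I) v u
  hop-sym' = hop-sym adj-sym

  Anchored : V' I → Hub → Set
  Anchored u h = Hop (Adj' I) u (hub h)

  Near : Hub → Hub → Set
  Near a b = Anchored (hub a) b

  near-sym : ∀ {a b} → Near a b → Near b a
  near-sym = hop-sym'

  anchor : ∀ v → ∃[ h ] Anchored v h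
  anchor (xv x)          = hXR , inj₂ (inj₂ eHXRx)
  anchor (yv y)          = hYR , inj₂ (inj₂ eHYRy)
  anchor (px c i)        = hPX , inj₂ (inj₂ eHPX)
  anchor (py c j)        = hPY , inj₂ (inj₂ eHPY)
  anchor (relay c i j p) = hXR , inj₂ (inj₂ eHXRr)
  anchor (hub h)         = h , inj₁ refl
  anchor (dummy h d)     = h , inj₂ (inj₂ (eDum d))

  record Star (w : V' I) : Set where
    field
      a b      : Hub
      a-near-b : Near a b
      anchored : ∀ {u} → Adj' I u w → Anchored u a ⊎ Anchored u b

  star-x : ∀ x → Star (xv x)
  star-x x = record { a = hPX ; b = hYR ; a-near-b = inj₂ (inj₁ eC1) ; anchored = nbr }
    where
    nbr : ∀ {u} → Adj' I u (xv x) → Anchored u hPX ⊎ Anchored u hYR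
    nbr (inj₁ eHXRx)   = inj₁ (inj₂ (inj₁ eC4))
    nbr (inj₂ (eG e))  = inj₂ (inj₂ (inj₂ eHYRy))
    nbr (inj₂ (eXP c)) = inj₁ (inj₂ (inj₂ eHPX))

  star-y : ∀ y → Star (yv y)
  star-y y = record { a = hPY ; b = hXR ; a-near-b = inj₂ (inj₁ eC3) ; anchored = nbr }
    where
    nbr : ∀ {u} → Adj' I u (yv y) → Anchored u hPY ⊎ Anchored u hXR
    nbr (inj₁ (eG e))  = inj₂ (inj₂ (inj₂ eHXRx))
    nbr (inj₁ eHYRy)   = inj₁ (inj₂ (inj₁ eC2))
    nbr (inj₂ (eYP c)) = inj₁ (inj₂ (inj₂ eHPY))

  star-px : ∀ c i → Star (px c i)
  star-px c i = record { a = hXR ; b = hXR ; a-near-b = inj₁ refl ; anchored = nbr }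
    where
    nbr : ∀ {u} → Adj' I u (px c i) → Anchored u hXR ⊎ Anchored u hXR
    nbr (inj₁ (eXP c))    = inj₁ (inj₂ (inj₂ eHXRx))
    nbr (inj₁ eHPX)       = inj₁ (inj₂ (inj₂ eC4))
    nbr (inj₂ (ePXR c p)) = inj₁ (inj₂ (inj₂ eHXRr))

  star-py : ∀ c j → Star (py c j)
  star-py c j = record { a = hYR ; b = hYR ; a-near-b = inj₁ refl ; anchored = nbr }
    where
    nbr : ∀ {u} → Adj' I u (py c j) → Anchored u hYR ⊎ Anchored u hYR
    nbr (inj₁ (eYP c))    = inj₁ (inj₂ (inj₂ eHYRy))
    nbr (inj₁ (eRPY c p)) = inj₁ (inj₂ (inj₂ eHYRr))
    nbr (inj₁ eHPY)       = inj₁ (inj₂ (inj₂ eC2))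

  star-dummy : ∀ h d → Star (dummy h d)
  star-dummy h d = record { a = h ; b = h ; a-near-b = inj₁ refl ; anchored = nbr }
    where
    nbr : ∀ {u} → Adj' I u (dummy h d) → Anchored u h ⊎ Anchored u h
    nbr (inj₁ (eDum d)) = inj₁ (inj₁ refl)

  data RelayNeighbour (c : Fin 2) (i : Fin kX) (j : Fin kY) : V' I → Set where
    at-px  : RelayNeighbour c i j (px c i)
    at-py  : RelayNeighbour c i j (py c j)
    at-hub : ∀ {u} → Anchored u hPX → Anchored u hPY → RelayNeighbour c i j u

  relayNeighbour : ∀ {u c i j p} → Adj' I u (relay c i j p) → RelayNeighbour c i j u
  relayNeighbour (inj₁ (ePXR c p)) = at-px
  relayNeighbour (inj₁ eHXRr)      = at-hub (inj₂ (inj₁ eC4)) (inj₂ (inj₂ eC3))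
  relayNeighbour (inj₁ eHYRr)      = at-hub (inj₂ (inj₂ eC1)) (inj₂ (inj₁ eC2))
  relayNeighbour (inj₂ (eRPY c p)) = at-py

module Solution (I : MinRep) (S : List (MinRep.X I ⊎ MinRep.Y I)) (F : MinRep.Feasible I S) where
  open MinRep I
  open Hubs I

  embed : X ⊎ Y → V' I
  embed (inj₁ x) = xv x
  embed (inj₂ y) = yv y

  D : List (V' I)
  D = hub hXR ∷ hub hYR ∷ hub hPX ∷ hub hPY ∷ map embed S

  hub∈D : ∀ h → hub h ∈ D
  hub∈D hXR = here refl
  hub∈D hYR = there (here refl)
  hub∈D hPX = there (there (here refl))
  hub∈D hPY = there (there (there (here refl)))

  S⊆D : ∀ {z} → z ∈ S → embed z ∈ D
  S⊆D z∈S = there (there (there (there (∈-map⁺ embed z∈S))))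

  dominating : Dominating (Adj' I) D
  dominating v with anchor v
  ... | h , inj₁ refl = inj₁ (hub∈D h)
  ... | h , inj₂ e    = inj₂ (hub h , hub∈D h , e)

  module _ {u v : V' I} where
    open Walks (Adj' I) (InDuv D u v)

    viaHubs : ∀ {a b} → Anchored u a → Near a b → Anchored v b → Covers (Adj' I) D u v
    viaHubs {a} {b} ua ab vb = shortWalk⇒m≤
      (hop-prepend (inj₂ (inj₁ refl)) ua
      (hop-prepend (inj₁ (hub∈D a)) ab
      (hop-prepend (inj₁ (hub∈D b)) (hop-sym' vb)
      (stay (inj₂ (inj₂ refl))))))

    sameHub : ∀ {h} → Anchored u h → Anchored v h → Covers (Adj' I) D u v
    sameHub uh vh = viaHubs uh (inj₁ refl) vh

    starCovers : ∀ {w} → Star w → Adj' I u w → Adj' I w v → Covers (Adj' I) D u v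
    starCovers s uw wv with Star.anchored s uw | Star.anchored s (adj-sym wv)
    ... | inj₁ ua | inj₁ va = sameHub ua va
    ... | inj₁ ua | inj₂ vb = viaHubs ua (Star.a-near-b s) vb
    ... | inj₂ ub | inj₁ va = viaHubs ub (near-sym (Star.a-near-b s)) va
    ... | inj₂ ub | inj₂ vb = sameHub ub vb

    hopCovers : Hop (Adj' I) u v → Covers (Adj' I) D u v
    hopCovers uv = shortWalk⇒m≤
      (weaken (s≤s z≤n) (hop-prepend (inj₂ (inj₁ refl)) uv (stay (inj₂ (inj₂ refl)))))

    throughS : ∀ {a b} → a ∈ S → b ∈ S →
               Adj' I u (embed a) → Adj' I (embed a) (embed b) → Adj' I (embed b) v →
               Covers (Adj' I) D u v
    throughS a∈S b∈S ua ab bv = shortWalk⇒m≤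
      (hop-prepend (inj₂ (inj₁ refl)) (inj₂ ua)
      (hop-prepend (inj₁ (S⊆D a∈S)) (inj₂ ab)
      (hop-prepend (inj₁ (S⊆D b∈S)) (inj₂ bv)
      (stay (inj₂ (inj₂ refl))))))

  -- The MIN-REP representatives of the super edge (X_i, Y_j) join px^c_i
  -- and py^c_j, in either direction.
  relayCovers : ∀ {c i j} → SuperEdge i j → ∀ {u v} →
                RelayNeighbour c i j u → RelayNeighbour c i j v → Covers (Adj' I) D u v
  relayCovers p at-px at-px = sameHub (inj₂ (inj₂ eHPX)) (inj₂ (inj₂ eHPX))
  relayCovers {c} {i} {j} p at-px at-py with F i j p
  ... | _ , _ , x∈S , y∈S , e =
    throughS x∈S y∈S (inj₂ (eXP c)) (inj₁ (eG e)) (inj₁ (eYP c))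
  relayCovers p at-px (at-hub va _) = sameHub (inj₂ (inj₂ eHPX)) va
  relayCovers {c} {i} {j} p at-py at-px with F i j p
  ... | _ , _ , x∈S , y∈S , e =
    throughS y∈S x∈S (inj₂ (eYP c)) (inj₂ (eG e)) (inj₁ (eXP c))
  relayCovers p at-py at-py = sameHub (inj₂ (inj₂ eHPY)) (inj₂ (inj₂ eHPY))
  relayCovers p at-py (at-hub _ vb) = sameHub (inj₂ (inj₂ eHPY)) vb
  relayCovers p (at-hub ua _) at-px = sameHub ua (inj₂ (inj₂ eHPX))
  relayCovers p (at-hub _ ub) at-py = sameHub ub (inj₂ (inj₂ eHPY))
  relayCovers p (at-hub ua _) (at-hub va _) = sameHub ua va

  commonNeighbourCovers : ∀ {u v} w → Adj' I u w → Adj' I w v → Covers (Adj' I) D u v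
  commonNeighbourCovers (hub h) uw wv = sameHub (inj₂ uw) (inj₂ (adj-sym wv))
  commonNeighbourCovers (xv x) = starCovers (star-x x)
  commonNeighbourCovers (yv y) = starCovers (star-y y)
  commonNeighbourCovers (px c i) = starCovers (star-px c i)
  commonNeighbourCovers (py c j) = starCovers (star-py c j)
  commonNeighbourCovers (dummy h d) = starCovers (star-dummy h d)
  commonNeighbourCovers (relay c i j p) uw wv =
    relayCovers p (relayNeighbour uw) (relayNeighbour (adj-sym wv))

  covers : ∀ u v → TargetCouple (Adj' I) u v → Covers (Adj' I) D u v
  covers u v (m≤1 , _) with m≤1⇒hop⊎common m≤1
  ... | inj₁ uv = hopCovers uv
  ... | inj₂ (w , uw , wv) = commonNeighbourCovers w uw wv

  embed-injective : ∀ {a b} → embed a ≡ embed b → a ≡ b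
  embed-injective {inj₁ x} {inj₁ .x} refl = refl
  embed-injective {inj₂ y} {inj₂ .y} refl = refl

  hub∉S : ∀ h → All (hub h ≢_) (map embed S)
  hub∉S h = All.map⁺ (universal hub≢embed S)
    where
    hub≢embed : ∀ z → hub h ≢ embed z
    hub≢embed (inj₁ x) ()
    hub≢embed (inj₂ y) ()

  unique : Unique S → Unique D
  unique uniqueS = ((λ ()) ∷ (λ ()) ∷ (λ ()) ∷ hub∉S hXR)
                 ∷ ((λ ()) ∷ (λ ()) ∷ hub∉S hYR)
                 ∷ ((λ ()) ∷ hub∉S hPX)
                 ∷ hub∉S hPY
                 ∷ Unique.map⁺ embed-injective uniqueS

  size : length D ≡ length S + 4
  size = trans (cong (4 +_) (length-map embed S)) (+-comm 4 (length S))

lemma8 : (I : MinRep) (s : ℕ) → MinRep.HasSolutionOfSize I s → DR2HasSolutionOfSize I (s + 4)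
lemma8 I s (S , feasible , uniqueS , refl) =
  D , (dominating , covers) , unique uniqueS , size
  where open Solution I S feasible
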